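{- The language $\mathcal{L}(\boxdot)$ is less expressive than the language $\mathcal{L}(\boxplus)$ on each of the following classes of bimodal models: the class of all bimodal models, the class of serial bimodal models, the class of transitive bimodal models, and the class of Euclidean bimodal models.
   Context: Fix a nonempty set $\mathbf{P}$ of propositional variables. $\mathcal{L}(\boxdot)$ is given by $\phi::=p\mid\neg\phi\mid(\phi\land\phi)\mid\boxdot\phi$ and $\mathcal{L}(\boxplus)$ by $\phi::=p\mid\neg\phi\mid(\phi\land\phi)\mid\boxplus\phi$, with $p\in\mathbf{P}$. A bimodal model is $\mathcal{M}=\langle S,R_1,R_2,V\rangle$ with $S$ nonempty, $R_1,R_2\subseteq S\times S$, and $V:\mathbf{P}\to\mathcal{P}(S)$. Write $R_i(s)=\{t\mid sR_it\}$. Boolean clauses are as usual; $\mathcal{M},s\vDash\boxdot\phi$ iff for all $t,u$ with $sR_1t$ and $sR_2u$, $(\mathcal{M},t\vDash\phi\iff\mathcal{M},u\vDash\phi)$; $\mathcal{M},s\vDash\boxplus\phi$ iff either $\mathcal{M},t\vDash\phi$ for all $t\in R_1(s)$, or $\mathcal{M},u\vDash\neg\phi$ for all $u\in R_2(s)$. A bimodal model is serial/transitive/Euclidean if both $R_1$ and $R_2$ have that property. For languages $\mathcal{L}_1,\mathcal{L}_2$ interpreted on a class $\mathbb{C}$ of models: $\mathcal{L}_1\preceq\mathcal{L}_2$ if for every $\phi\in\mathcal{L}_1$ there is $\psi\in\mathcal{L}_2$ with $\mathcal{M},s\vDash\phi\iff\mathcal{M},s\vDash\psi$ for all $\mathcal{M}\in\mathbb{C}$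 and all $s$ in $\mathcal{M}$; $\mathcal{L}_1$ is less expressive than $\mathcal{L}_2$ if $\mathcal{L}_1\preceq\mathcal{L}_2$ but not $\mathcal{L}_2\preceq\mathcal{L}_1$. -}

module Defs where

open import Data.Unit using (⊤)
open import Data.Product using (Σ; _×_; _,_)
open import Data.Sum using (_⊎_)
open import Relation.Nullary using (¬_)

record Model (P : Set) : Set₁ where
  field
    S  : Set
    s₀ : S                      -- S is nonempty
    R₁ : S → S → Set
    R₂ : S → S → Set
    V  : P → S → Set            -- s ∈ V p  is  V p s

open Model public

data Fm⊡ (P : Set) : Set where
  var : P → Fm⊡ P
  ¬'_ : Fm⊡ P → Fm⊡ P
  _∧'_ : Fm⊡ P → Fm⊡ P → Fm⊡ P
  ⊡_  : Fm⊡ P → Fm⊡ P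

data Fm⊞ (P : Set) : Set where
  var : P → Fm⊞ P
  ¬'_ : Fm⊞ P → Fm⊞ P
  _∧'_ : Fm⊞ P → Fm⊞ P → Fm⊞ P
  ⊞_  : Fm⊞ P → Fm⊞ P

sat⊡ : {P : Set} (M : Model P) → S M → Fm⊡ P → Set
sat⊡ M s (var p)   = V M p s
sat⊡ M s (¬' φ)    = ¬ sat⊡ M s φ
sat⊡ M s (φ ∧' ψ)  = sat⊡ M s φ × sat⊡ M s ψ
sat⊡ M s (⊡ φ)     = ∀ t u → R₁ M s t → R₂ M s u →
                       (sat⊡ M t φ → sat⊡ M u φ) × (sat⊡ M u φ → sat⊡ M t φ)

sat⊞ : {P : Set} (M : Model P) → S M → Fm⊞ P → Set
sat⊞ M s (var p)   = V M p s
sat⊞ M s (¬' φ)    = ¬ sat⊞ M s φ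
sat⊞ M s (φ ∧' ψ)  = sat⊞ M s φ × sat⊞ M s ψ
sat⊞ M s (⊞ φ)     = (∀ t → R₁ M s t → sat⊞ M t φ)
                     ⊎ (∀ u → R₂ M s u → ¬ sat⊞ M u φ)

ModelClass : Set → Set₁
ModelClass P = Model P → Set

Serial : {S : Set} → (S → S → Set) → Set
Serial {S} R = ∀ s → Σ S (λ t → R s t)

Transitive : {S : Set} → (S → S → Set) → Set
Transitive {S} R = ∀ {s t u : S} → R s t → R t u → R s u

Euclidean : {S : Set} → (S → S → Set) → Set
Euclidean {S} R = ∀ {s t u : S} → R s t → R s u → R t u

data ClassName : Set where
  allModels serial transitive euclidean : ClassName

⟦_⟧ : ClassName → {P : Set} → ModelClass P
⟦ allModels  ⟧ M = ⊤
⟦ serial     ⟧ M = Serial (R₁ M) × Serial (R₂ M)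
⟦ transitive ⟧ M = Transitive (R₁ M) × Transitive (R₂ M)
⟦ euclidean  ⟧ M = Euclidean (R₁ M) × Euclidean (R₂ M)

⊡⪯⊞ : {P : Set} → ModelClass P → Set₁
⊡⪯⊞ {P} C = (φ : Fm⊡ P) → Σ (Fm⊞ P) λ ψ →
  (M : Model P) → C M → (s : S M) →
  (sat⊡ M s φ → sat⊞ M s ψ) × (sat⊞ M s ψ → sat⊡ M s φ)

⊞⪯⊡ : {P : Set} → ModelClass P → Set₁
⊞⪯⊡ {P} C = (φ : Fm⊞ P) → Σ (Fm⊡ P) λ ψ →
  (M : Model P) → C M → (s : S M) →
  (sat⊞ M s φ → sat⊡ M s ψ) × (sat⊡ M s ψ → sat⊞ M s φ)

⊡LessExpressive⊞ : {P : Set} → ModelClass P → Set₁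
⊡LessExpressive⊞ C = ⊡⪯⊞ C × ¬ ⊞⪯⊡ C

module Submission where

-- L(⊡) ⪯ L(⊞): classically, ⊡φ says exactly that the R₁-successors and the
-- R₂-successors cannot disagree on φ, i.e. ⊞φ ∧ ⊞¬φ.  We prove this at the
-- level of the semantic clauses (for an arbitrary predicate A in place of
-- the truth set of φ) and obtain a compositional translation ⊡φ ↦ ⊞φ ∧ ⊞¬φ.
--
-- not L(⊞) ⪯ L(⊡): the clause of ⊡ is symmetric in R₁ and R₂, so no
-- L(⊡)-formula can tell a model M from its swap (R₁ and R₂ exchanged),
-- whereas ⊞p can.  A two-point model where R₁ points to a p-world and R₂ to
-- a ¬p-world, whose relations are serial, transitive and Euclidean, makes
-- ⊞p true at a point of M and false at the same point of the swap.

open import Defs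
open import Level using (0ℓ)
open import Axiom.ExcludedMiddle using (ExcludedMiddle)
open import Axiom.DoubleNegationElimination using (em⇒dne)
open import Data.Unit using (tt)
open import Data.Bool using (Bool; true; false)
open import Data.Product using (_×_; _,_)
open import Data.Product.Function.NonDependent.Propositional using (_×-⇔_)
open import Data.Sum using (_⊎_; inj₁; inj₂)
open import Data.Empty using (⊥-elim)
open import Function.Bundles using (_⇔_; mk⇔; Equivalence)
open import Function.Construct.Identity using (⇔-id)
open import Function.Construct.Symmetry using (⇔-sym)
open import Function.Construct.Composition using (_⇔-∘_)
open import Function.Related.TypeIsomorphisms using (¬-cong-⇔)
open import Relation.Nullary using (¬_; yes; no)
open import Relation.Binary.PropositionalEquality using (_≡_; refl)

open Equivalence using (to; from)

⊡-sem : {W : Set} → (W → W → Set) → (W → W → Set) → (W → Set) → W → Set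
⊡-sem R₁ R₂ A s = ∀ t u → R₁ s t → R₂ s u → (A t → A u) × (A u → A t)

⊞-sem : {W : Set} → (W → W → Set) → (W → W → Set) → (W → Set) → W → Set
⊞-sem R₁ R₂ A s = (∀ t → R₁ s t → A t) ⊎ (∀ u → R₂ s u → ¬ A u)

⊡-sem-cong : {W : Set} (R₁ R₂ : W → W → Set) {A B : W → Set} →
  (∀ x → A x ⇔ B x) → ∀ s → ⊡-sem R₁ R₂ A s ⇔ ⊡-sem R₁ R₂ B s
⊡-sem-cong R₁ R₂ A⇔B s =
  mk⇔ (transport A⇔B) (transport (λ x → ⇔-sym (A⇔B x)))
  where
  transport : ∀ {A B} → (∀ x → A x ⇔ B x) → ⊡-sem R₁ R₂ A s → ⊡-sem R₁ R₂ B s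
  transport A⇔B h t u r₁ r₂ with h t u r₁ r₂
  ... | t⇒u , u⇒t =
    (λ bt → to (A⇔B u) (t⇒u (from (A⇔B t) bt))) ,
    (λ bu → to (A⇔B t) (u⇒t (from (A⇔B u) bu)))

⊡-sem-swap : {W : Set} (R₁ R₂ : W → W → Set) (A : W → Set) →
  ∀ s → ⊡-sem R₁ R₂ A s ⇔ ⊡-sem R₂ R₁ A s
⊡-sem-swap R₁ R₂ A s = mk⇔ (exchange R₁ R₂) (exchange R₂ R₁)
  where
  exchange : ∀ Q₁ Q₂ → ⊡-sem Q₁ Q₂ A s → ⊡-sem Q₂ Q₁ A s
  exchange Q₁ Q₂ h t u q₂ q₁ with h u t q₁ q₂
  ... | u⇒t , t⇒u = t⇒u , u⇒t

-- Classically, ⊡A holds iff ⊞A and ⊞¬A both hold: "R₁ and R₂ successors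
-- agree on A" means neither some R₁-successor fails A while some
-- R₂-successor satisfies it, nor the other way round.
⊡-sem⇔⊞-sem-pair : ExcludedMiddle 0ℓ → {W : Set} (R₁ R₂ : W → W → Set) (A : W → Set) →
  ∀ s → ⊡-sem R₁ R₂ A s ⇔ (⊞-sem R₁ R₂ A s × ⊞-sem R₁ R₂ (λ x → ¬ A x) s)
⊡-sem⇔⊞-sem-pair lem R₁ R₂ A s = mk⇔ (λ h → ⊞A h , ⊞¬A h) agree
  where
  ⊞A : ⊡-sem R₁ R₂ A s → ⊞-sem R₁ R₂ A s
  ⊞A h with lem {∀ t → R₁ s t → A t}
  ... | yes all₁ = inj₁ all₁
  ... | no ¬all₁ = inj₂ λ u r₂ au → ¬all₁ λ t r₁ → let (_ , u⇒t) = h t u r₁ r₂ in u⇒t au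

  ⊞¬A : ⊡-sem R₁ R₂ A s → ⊞-sem R₁ R₂ (λ x → ¬ A x) s
  ⊞¬A h with lem {∀ t → R₁ s t → ¬ A t}
  ... | yes none₁ = inj₁ none₁
  ... | no ¬none₁ = inj₂ λ u r₂ ¬au → ¬none₁ λ t r₁ at → let (t⇒u , _) = h t u r₁ r₂ in ¬au (t⇒u at)

  agree : ⊞-sem R₁ R₂ A s × ⊞-sem R₁ R₂ (λ x → ¬ A x) s → ⊡-sem R₁ R₂ A s
  agree (inj₁ all₁  , inj₁ none₁) t u r₁ r₂ = ⊥-elim (none₁ t r₁ (all₁ t r₁))
  agree (inj₁ all₁  , inj₂ all₂ ) t u r₁ r₂ = (λ _ → em⇒dne lem (all₂ u r₂)) , (λ _ → all₁ t r₁)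
  agree (inj₂ none₂ , inj₁ none₁) t u r₁ r₂ = (λ at → ⊥-elim (none₁ t r₁ at)) , (λ au → ⊥-elim (none₂ u r₂ au))
  agree (inj₂ none₂ , inj₂ all₂ ) t u r₁ r₂ = ⊥-elim (all₂ u r₂ (none₂ u r₂))

translate : {P : Set} → Fm⊡ P → Fm⊞ P
translate (var p)  = var p
translate (¬' φ)   = ¬' translate φ
translate (φ ∧' ψ) = translate φ ∧' translate ψ
translate (⊡ φ)    = (⊞ translate φ) ∧' (⊞ (¬' translate φ))

translate-correct : ExcludedMiddle 0ℓ → {P : Set} (M : Model P) (φ : Fm⊡ P) →
  ∀ s → sat⊡ M s φ ⇔ sat⊞ M s (translate φ)
translate-correct lem M (var p)  s = ⇔-id _
translate-correct lem M (¬' φ)   s = ¬-cong-⇔ (translate-correct lem M φ s)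
translate-correct lem M (φ ∧' ψ) s = translate-correct lem M φ s ×-⇔ translate-correct lem M ψ s
translate-correct lem M (⊡ φ)    s =
  ⊡-sem⇔⊞-sem-pair lem (R₁ M) (R₂ M) (λ x → sat⊞ M x (translate φ)) s
  ⇔-∘ ⊡-sem-cong (R₁ M) (R₂ M) (translate-correct lem M φ) s

swap : {P : Set} → Model P → Model P
swap M = record { S = S M ; s₀ = s₀ M ; R₁ = R₂ M ; R₂ = R₁ M ; V = V M }

swap-invariant : {P : Set} (M : Model P) (φ : Fm⊡ P) →
  ∀ s → sat⊡ M s φ ⇔ sat⊡ (swap M) s φ
swap-invariant M (var p)  s = ⇔-id _
swap-invariant M (¬' φ)   s = ¬-cong-⇔ (swap-invariant M φ s)
swap-invariant M (φ ∧' ψ) s = swap-invariant M φ s ×-⇔ swap-invariant M ψ s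
swap-invariant M (⊡ φ)    s =
  ⊡-sem-swap (R₁ M) (R₂ M) (λ x → sat⊡ (swap M) x φ) s ⇔-∘ ⊡-sem-cong (R₁ M) (R₂ M) (swap-invariant M φ) s

swap-separation⇒¬⊞⪯⊡ : {P : Set} {C : ModelClass P} (M : Model P) →
  C M → C (swap M) → (χ : Fm⊞ P) (s : S M) →
  sat⊞ M s χ → ¬ sat⊞ (swap M) s χ → ¬ ⊞⪯⊡ C
swap-separation⇒¬⊞⪯⊡ M CM Cswap χ s χ-in-M χ-not-in-swap ⊞⪯⊡C
  with ⊞⪯⊡C χ
... | ψ , defines = χ-not-in-swap (from-swap (to (swap-invariant M ψ s) (to-M χ-in-M)))
  where
  to-M : sat⊞ M s χ → sat⊡ M s ψ
  to-M = let (h , _) = defines M CM s in h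
  from-swap : sat⊡ (swap M) s ψ → sat⊞ (swap M) s χ
  from-swap = let (_ , h) = defines (swap M) Cswap s in h

towards : Bool → Bool → Bool → Set
towards b _ y = y ≡ b

-- The two-point model where R₁ points to b₁, R₂ to b₂, and every variable
-- holds exactly at true.  Its swap is twoPoint b₂ b₁ (definitionally).
twoPoint : (P : Set) → Bool → Bool → Model P
twoPoint P b₁ b₂ = record
  { S = Bool ; s₀ = true ; R₁ = towards b₁ ; R₂ = towards b₂ ; V = λ _ x → x ≡ true }

twoPoint-in-class : (P : Set) (c : ClassName) (b₁ b₂ : Bool) → ⟦ c ⟧ (twoPoint P b₁ b₂)
twoPoint-in-class P allModels  b₁ b₂ = tt
twoPoint-in-class P serial     b₁ b₂ = (λ _ → b₁ , refl) , (λ _ → b₂ , refl)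
twoPoint-in-class P transitive b₁ b₂ = (λ _ r → r) , (λ _ r → r)
twoPoint-in-class P euclidean  b₁ b₂ = (λ _ r → r) , (λ _ r → r)

⊞p-true : {P : Set} (p : P) → sat⊞ (twoPoint P true false) true (⊞ var p)
⊞p-true p = inj₁ λ _ r₁ → r₁

⊞p-false : {P : Set} (p : P) → ¬ sat⊞ (twoPoint P false true) true (⊞ var p)
⊞p-false p (inj₁ all₁) with all₁ false refl
... | ()
⊞p-false p (inj₂ none₂) = none₂ true refl refl

proposition3p2 : ExcludedMiddle 0ℓ → (P : Set) → P → (c : ClassName) →
    ⊡LessExpressive⊞ {P} ⟦ c ⟧
proposition3p2 lem P p c = ⊡⪯⊞-proof , ¬⊞⪯⊡
  where
  ⊡⪯⊞-proof : ⊡⪯⊞ ⟦ c ⟧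
  ⊡⪯⊞-proof φ = translate φ , λ M _ s →
    let e = translate-correct lem M φ s in to e , from e

  ¬⊞⪯⊡ : ¬ ⊞⪯⊡ ⟦ c ⟧
  ¬⊞⪯⊡ = swap-separation⇒¬⊞⪯⊡ (twoPoint P true false)
    (twoPoint-in-class P c true false) (twoPoint-in-class P c false true)
    (⊞ var p) true (⊞p-true p) (⊞p-false p)
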